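{- Let $n \geq 1$ and $N = 2^n$. Every DeMorgan circuit computing $\mathrm{MUX}_n$ has size at least $2N + \log N - 2$ (i.e. at least $2\cdot 2^n + n - 2$).
   Context: A DeMorgan circuit is a Boolean circuit whose gates are binary AND gates, binary OR gates, and (unary) NOT gates. The size of a circuit is the number of its binary gates (NOT gates are not counted). The multiplexer $\mathrm{MUX}_n : \{0,1\}^n \times \{0,1\}^{2^n} \to \{0,1\}$ takes $n$ address bits $\vec a = (a_1,\dots,a_n)$ and $2^n$ data bits $\vec x = (x_1,\dots,x_{2^n})$ and outputs the data bit $x_{(\vec a)+1}$, where $(\vec a)$ denotes the integer whose base-2 representation is $\vec a$. Logarithms are base 2. -}

module Defs where

open import Data.Nat using (ℕ; zero; suc; _+_; _*_; _^_; _<_; z≤n; s≤s)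
open import Data.Nat.Properties
  using (+-identityʳ; +-suc; <-≤-trans; m≤m+n; +-monoʳ-<)
open import Data.Fin using (Fin; fromℕ<)
open import Data.Bool using (Bool; true; false; _∧_; _∨_; not; if_then_else_)
open import Data.Vec using (Vec; []; _∷_; lookup; _∷ʳ_; _++_)
open import Relation.Binary.PropositionalEquality using (_≡_; subst; sym; cong)

-- A gate placed after k earlier gates in a circuit with m inputs.
-- Operands are nodes: index into Fin (m + k) = the m inputs followed by
-- the k earlier gates (in order).
data Gate (m k : ℕ) : Set where
  AND : Fin (m + k) → Fin (m + k) → Gate m k
  OR  : Fin (m + k) → Fin (m + k) → Gate m k
  NOT : Fin (m + k) → Gate m k

-- A DeMorgan circuit body: a straight-line program (a DAG in topological
-- order) with k gates, stored newest-first.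
data Gates (m : ℕ) : ℕ → Set where
  []  : Gates m zero
  _∷_ : ∀ {k} → Gate m k → Gates m k → Gates m (suc k)

record Circuit (m : ℕ) : Set where
  constructor circuit
  field
    numGates : ℕ
    gates    : Gates m numGates
    output   : Fin (m + numGates)
open Circuit public

gateSize : ∀ {m k} → Gate m k → ℕ
gateSize (AND _ _) = 1
gateSize (OR _ _)  = 1
gateSize (NOT _)   = 0

gatesSize : ∀ {m k} → Gates m k → ℕ
gatesSize []       = 0
gatesSize (g ∷ gs) = gateSize g + gatesSize gs

size : ∀ {m} → Circuit m → ℕ
size c = gatesSize (gates c)

evalGate : ∀ {m k} → Gate m k → Vec Bool (m + k) → Bool
evalGate (AND i j) v = lookup v i ∧ lookup v j
evalGate (OR i j)  v = lookup v i ∨ lookup v j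
evalGate (NOT i)   v = not (lookup v i)

evalGates : ∀ {m k} → Gates m k → Vec Bool m → Vec Bool (m + k)
evalGates {m} {zero} [] x = subst (Vec Bool) (sym (+-identityʳ m)) x
evalGates {m} {suc k} (g ∷ gs) x =
  subst (Vec Bool) (sym (+-suc m k)) (vs ∷ʳ evalGate g vs)
  where vs = evalGates gs x

eval : ∀ {m} → Circuit m → Vec Bool m → Bool
eval c x = lookup (evalGates (gates c) x) (output c)

binVal : ∀ {n} → Vec Bool n → ℕ
binVal {zero}  []       = 0
binVal {suc n} (b ∷ bs) = (if b then 2 ^ n else 0) + binVal bs

binVal< : ∀ {n} (a : Vec Bool n) → binVal a < 2 ^ n
binVal< {zero}  []          = s≤s z≤n
binVal< {suc n} (false ∷ a) = <-≤-trans (binVal< a) (m≤m+n (2 ^ n) (2 ^ n + 0))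
binVal< {suc n} (true ∷ a)  =
  subst (λ t → 2 ^ n + binVal a < t) (sym (cong (2 ^ n +_) (+-identityʳ (2 ^ n))))
        (+-monoʳ-< (2 ^ n) (binVal< a))

-- MUX_n(a, x) = x_{(a)+1} (1-based), i.e. data bit with 0-based index (a).
MUX : (n : ℕ) → Vec Bool n → Vec Bool (2 ^ n) → Bool
MUX n a x = lookup x (fromℕ< (binVal< a))

Computes-MUX : (n : ℕ) → Circuit (n + 2 ^ n) → Set
Computes-MUX n c = ∀ (a : Vec Bool n) (x : Vec Bool (2 ^ n)) → eval c (a ++ x) ≡ MUX n a x

{-# OPTIONS --safe #-}

-- Gate elimination.  A binary gate is live on a subcube S if neither operand
-- is constant on S, so a circuit has at most size-many live gates.  Let the
-- output depend on a variable v that S leaves free.  Every node is independent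
-- of v on S, or lies in the class generated from x_v by gates whose other
-- operand is constant on S, or else some live gate is fed from that class.
-- Taking for the class the functions of x_v alone, the live gate found is fed
-- by x_v or its negation, so some v := c gives it its controlling value and
-- kills it; rerunning the argument on S ∩ {v = c}, with that gate added to the
-- class, kills a second one.  For MUX_n, fixing the data bits
-- x_{N-1}, …, x_1 kills two gates each, and then fixing the address bits to 0
-- kills one each (the output still depends on them through x_0): 2N - 2 + n.
module Submission where

open import Defs
open import Algebra.Core using (Op₂)
open import Data.Bool using (Bool; true; false; not; _∧_; _∨_) renaming (_≟_ to _≟ᴮ_)
open import Data.Bool.Properties using (∧-zeroʳ; ∨-zeroʳ; not-¬; ¬-not)
open import Data.Empty using (⊥; ⊥-elim)
open import Data.Fin using (Fin; zero; suc; toℕ; fromℕ<; _↑ˡ_; _↑ʳ_; splitAt; _≟_)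
open import Data.Fin.Properties
  using (all?; toℕ-fromℕ<; toℕ-injective; toℕ<n; ↑ˡ-injective; ↑ʳ-injective; splitAt-↑ˡ; splitAt-↑ʳ)
open import Data.Fin.Subset.Properties using (anySubset?)
open import Data.Nat using (ℕ; zero; suc; pred; _+_; _*_; _^_; _∸_; _≤_; _<_; z≤n; s≤s; _≤?_; _<?_)
open import Data.Nat.Properties
  using (+-identityʳ; +-suc; +-assoc; +-comm; *-suc; ≤-refl; ≤-reflexive; ≤-trans; <-≤-trans; ≤-<-trans;
         <⇒≤; <⇒≢; ≮⇒≥; m<n⇒m<1+n; m≤m+n; m≤n+m; m+[n∸m]≡n; +-mono-≤; +-monoʳ-≤; +-mono-<-≤;
         +-mono-≤-<; +-cancelˡ-<; m^n>0; m^n≢0; suc-pred; module ≤-Reasoning)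
open import Data.Product using (∃; _×_; _,_; proj₁)
import Data.Product as Product
open import Data.Sum using (_⊎_; inj₁; inj₂; [_,_]; [_,_]′)
import Data.Sum as Sum
open import Data.Vec using (Vec; []; _∷_; lookup; _++_; _∷ʳ_; replicate; updateAt; _[_]≔_)
open import Data.Vec.Properties
  using (lookup∘updateAt; lookup∘updateAt′; lookup∘update; lookup∘update′; lookup-++ˡ; lookup-++ʳ; lookup-replicate)
open import Function using (_∘_; _$_; id; flip)
open import Level using (0ℓ)
open import Relation.Binary.PropositionalEquality hiding ([_])
open import Relation.Nullary using (¬_; Dec; yes; no; contradiction)
open import Relation.Nullary.Decidable using (map′; decidable-stable; ¬?; _×-dec_; _→-dec_)
open import Relation.Unary using (Pred; Decidable; _∈_; _∉_; _⊆_; _∩_; ∅)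
open import Relation.Unary.Properties using (∁?; _∩?_; ∅?)

private
  variable
    m k : ℕ

Cube : ℕ → Set
Cube = Vec Bool

flipAt : Fin m → Cube m → Cube m
flipAt v x = updateAt x v not

updateAt-++ˡ : ∀ {A : Set} {p q} (a : Vec A p) (x : Vec A q) i {f : A → A} →
               updateAt (a ++ x) (i ↑ˡ q) f ≡ updateAt a i f ++ x
updateAt-++ˡ (b ∷ a) x zero    = refl
updateAt-++ˡ (b ∷ a) x (suc i) = cong (b ∷_) (updateAt-++ˡ a x i)

updateAt-++ʳ : ∀ {A : Set} {p q} (a : Vec A p) (x : Vec A q) j {f : A → A} →
               updateAt (a ++ x) (p ↑ʳ j) f ≡ a ++ updateAt x j f
updateAt-++ʳ []      x j = refl
updateAt-++ʳ (b ∷ a) x j = cong (b ∷_) (updateAt-++ʳ a x j)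

-- Subset n is Vec Bool n, so anySubset? searches the whole cube.
∀-cube? : {P : Pred (Cube m) 0ℓ} → Decidable P → Dec (∀ x → P x)
∀-cube? P? with anySubset? (∁? P?)
... | yes (x , ¬Px) = no λ ∀P → ¬Px (∀P x)
... | no ∄¬P        = yes λ x → decidable-stable (P? x) (λ ¬Px → ∄¬P (x , ¬Px))

Constant : Pred (Cube m) 0ℓ → (Cube m → Bool) → Set
Constant S φ = ∀ {x y} → x ∈ S → y ∈ S → φ x ≡ φ y

constant? : {S : Pred (Cube m) 0ℓ} → Decidable S → ∀ φ → Dec (Constant S φ)
constant? S? φ = map′ (λ h {x} {y} → h x y) (λ h x y → h)
  (∀-cube? λ x → ∀-cube? λ y → S? x →-dec (S? y →-dec (φ x ≟ᴮ φ y)))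

module _ {S : Pred (Cube m) 0ℓ} where

  Constant-⊆ : ∀ {S′ φ} → S′ ⊆ S → Constant S φ → Constant S′ φ
  Constant-⊆ S′⊆S const x∈ y∈ = const (S′⊆S x∈) (S′⊆S y∈)

  Constant-resp : ∀ {φ ψ} → φ ≗ ψ → Constant S φ → Constant S ψ
  Constant-resp φ≗ψ const {x} {y} x∈ y∈ =
    trans (sym (φ≗ψ x)) (trans (const x∈ y∈) (φ≗ψ y))

  Constant-op : ∀ (f : Op₂ Bool) {u w} → Constant S u → Constant S w →
                Constant S (λ x → f (u x) (w x))
  Constant-op f u-const w-const x∈ y∈ = cong₂ f (u-const x∈ y∈) (w-const x∈ y∈)

Independent : Pred (Cube m) 0ℓ → Fin m → (Cube m → Bool) → Set
Independent S v φ = ∀ {x} → x ∈ S → φ x ≡ φ (flipAt v x)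

node : Gates m k → Fin (m + k) → Cube m → Bool
node gs i x = lookup (evalGates gs x) i

data PlacedGate (m : ℕ) : Set where
  _⊢_ : Gates m k → Gate m k → PlacedGate m

value : PlacedGate m → Cube m → Bool
value (gs ⊢ g) x = evalGate g (evalGates gs x)

gateAt : Gates m k → Fin k → PlacedGate m
gateAt (g ∷ gs) zero    = gs ⊢ g
gateAt (g ∷ gs) (suc p) = gateAt gs p

lookup-subst : ∀ {A : Set} {a b} (e : a ≡ b) (xs : Vec A b) (i : Fin a) →
               lookup (subst (Vec A) (sym e) xs) i ≡ lookup xs (subst Fin e i)
lookup-subst refl xs i = refl

lookup-∷ʳ : ∀ {A : Set} {n} (i : Fin (suc n)) →
            (∃ λ j → ∀ (xs : Vec A n) y → lookup (xs ∷ʳ y) i ≡ lookup xs j)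
            ⊎ (∀ (xs : Vec A n) y → lookup (xs ∷ʳ y) i ≡ y)
lookup-∷ʳ {n = zero}  zero    = inj₂ λ { [] y → refl }
lookup-∷ʳ {n = suc n} zero    = inj₁ (zero , λ { (x ∷ xs) y → refl })
lookup-∷ʳ {n = suc n} (suc i) with lookup-∷ʳ i
... | inj₁ (j , old) = inj₁ (suc j , λ { (x ∷ xs) y → old xs y })
... | inj₂ new       = inj₂ λ { (x ∷ xs) y → new xs y }

node-input : (i : Fin (m + 0)) → node [] i ≗ λ x → lookup x (subst Fin (+-identityʳ m) i)
node-input {m} i x = lookup-subst (+-identityʳ m) x i

node-∷ : (g : Gate m k) (gs : Gates m k) (i : Fin (m + suc k)) →
         (∃ λ j → node (g ∷ gs) i ≗ node gs j) ⊎ (node (g ∷ gs) i ≗ value (gs ⊢ g))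
node-∷ {m} {k} g gs i with lookup-∷ʳ (subst Fin (+-suc m k) i)
... | inj₁ (j , old) = inj₁ (j , λ x → trans (lookup-subst (+-suc m k) _ i) (old (evalGates gs x) _))
... | inj₂ new       = inj₂ λ x → trans (lookup-subst (+-suc m k) _ i) (new (evalGates gs x) _)

Operands : ((Cube m → Bool) → (Cube m → Bool) → Set) → PlacedGate m → Set
Operands R (gs ⊢ AND a b) = R (node gs a) (node gs b)
Operands R (gs ⊢ OR a b)  = R (node gs a) (node gs b)
Operands R (gs ⊢ NOT a)   = ⊥

Operands-map : ∀ {R R′ : (Cube m → Bool) → (Cube m → Bool) → Set} γ →
               (∀ {u w} → R u w → R′ u w) → Operands R γ → Operands R′ γ
Operands-map (gs ⊢ AND a b) f = f
Operands-map (gs ⊢ OR a b)  f = f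
Operands-map (gs ⊢ NOT a)   f = id

Live : Pred (Cube m) 0ℓ → PlacedGate m → Set
Live S = Operands λ u w → ¬ Constant S u × ¬ Constant S w

FedBy : Pred (Cube m → Bool) 0ℓ → PlacedGate m → Set
FedBy K = Operands λ u w → K u ⊎ K w

live? : {S : Pred (Cube m) 0ℓ} → Decidable S → ∀ γ → Dec (Live S γ)
live? S? (gs ⊢ AND a b) = ¬? (constant? S? _) ×-dec ¬? (constant? S? _)
live? S? (gs ⊢ OR a b)  = ¬? (constant? S? _) ×-dec ¬? (constant? S? _)
live? S? (gs ⊢ NOT a)   = no id

Live-⊆ : ∀ {S S′ : Pred (Cube m) 0ℓ} γ → S′ ⊆ S → Live S′ γ → Live S γ
Live-⊆ γ S′⊆S = Operands-map γ (Product.map (_∘ Constant-⊆ S′⊆S) (_∘ Constant-⊆ S′⊆S))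

FedBy-Constant⇒¬Live : ∀ {S : Pred (Cube m) 0ℓ} γ → FedBy (Constant S) γ → ¬ Live S γ
FedBy-Constant⇒¬Live (gs ⊢ AND a b) fed (¬cu , ¬cw) = [ ¬cu , ¬cw ] fed
FedBy-Constant⇒¬Live (gs ⊢ OR a b)  fed (¬cu , ¬cw) = [ ¬cu , ¬cw ] fed

indicator : ∀ {P : Set} → Dec P → ℕ
indicator (yes _) = 1
indicator (no _)  = 0

indicator≤1 : ∀ {P : Set} (P? : Dec P) → indicator P? ≤ 1
indicator≤1 (yes _) = ≤-refl
indicator≤1 (no _)  = z≤n

indicator-mono : ∀ {P Q : Set} (P? : Dec P) (Q? : Dec Q) → (P → Q) → indicator P? ≤ indicator Q?
indicator-mono (yes p) (yes _) _   = ≤-refl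
indicator-mono (yes p) (no ¬q) P⇒Q = contradiction (P⇒Q p) ¬q
indicator-mono (no _)  _       _   = z≤n

indicator-< : ∀ {P Q : Set} (P? : Dec P) (Q? : Dec Q) → ¬ P → Q → indicator P? < indicator Q?
indicator-< (yes p) _       ¬p _ = contradiction p ¬p
indicator-< (no _)  (yes _) _  _ = ≤-refl
indicator-< (no _)  (no ¬q) _  q = contradiction q ¬q

liveCount : {S : Pred (Cube m) 0ℓ} → Decidable S → Gates m k → ℕ
liveCount S? []       = 0
liveCount S? (g ∷ gs) = indicator (live? S? (gs ⊢ g)) + liveCount S? gs

liveCount≤size : {S : Pred (Cube m) 0ℓ} (S? : Decidable S) (gs : Gates m k) →
                 liveCount S? gs ≤ gatesSize gs
liveCount≤size S? []       = z≤n
liveCount≤size S? (g ∷ gs) = +-mono-≤ (counted g) (liveCount≤size S? gs)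
  where
  counted : ∀ g → indicator (live? S? (gs ⊢ g)) ≤ gateSize g
  counted (AND a b) = indicator≤1 (live? S? (gs ⊢ AND a b))
  counted (OR a b)  = indicator≤1 (live? S? (gs ⊢ OR a b))
  counted (NOT a)   = z≤n

module _ {S S′ : Pred (Cube m) 0ℓ} (S′? : Decidable S′) (S? : Decidable S) (S′⊆S : S′ ⊆ S)
  where

  private
    live-mono : ∀ {k} (g : Gate m k) gs →
                indicator (live? S′? (gs ⊢ g)) ≤ indicator (live? S? (gs ⊢ g))
    live-mono g gs =
      indicator-mono (live? S′? (gs ⊢ g)) (live? S? (gs ⊢ g)) (Live-⊆ {S = S} (gs ⊢ g) S′⊆S)

  liveCount-mono : (gs : Gates m k) → liveCount S′? gs ≤ liveCount S? gs
  liveCount-mono []       = z≤n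
  liveCount-mono (g ∷ gs) = +-mono-≤ (live-mono g gs) (liveCount-mono gs)

  private
    killed-here : ∀ {k} (g : Gate m k) gs → Live S (gs ⊢ g) → ¬ Live S′ (gs ⊢ g) →
                  indicator (live? S′? (gs ⊢ g)) < indicator (live? S? (gs ⊢ g))
    killed-here g gs live dead = indicator-< (live? S′? (gs ⊢ g)) (live? S? (gs ⊢ g)) dead live

  liveCount-kill : (gs : Gates m k) (p : Fin k) → Live S (gateAt gs p) → ¬ Live S′ (gateAt gs p) →
                   liveCount S′? gs < liveCount S? gs
  liveCount-kill (g ∷ gs) zero    live dead =
    +-mono-<-≤ (killed-here g gs live dead) (liveCount-mono gs)
  liveCount-kill (g ∷ gs) (suc p) live dead =
    +-mono-≤-< (live-mono g gs) (liveCount-kill gs p live dead)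

  liveCount-kill₂ : (gs : Gates m k) (p q : Fin k) → p ≢ q →
                    Live S (gateAt gs p) → ¬ Live S′ (gateAt gs p) →
                    Live S (gateAt gs q) → ¬ Live S′ (gateAt gs q) →
                    2 + liveCount S′? gs ≤ liveCount S? gs
  liveCount-kill₂ (g ∷ gs) zero zero p≢q _ _ _ _ = contradiction refl p≢q
  liveCount-kill₂ (g ∷ gs) zero (suc q) _ live-p dead-p live-q dead-q =
    subst (_≤ liveCount S? (g ∷ gs)) (cong suc (+-suc _ _))
      (+-mono-≤ (killed-here g gs live-p dead-p) (liveCount-kill gs q live-q dead-q))
  liveCount-kill₂ (g ∷ gs) (suc p) zero _ live-p dead-p live-q dead-q =
    subst (_≤ liveCount S? (g ∷ gs)) (cong suc (+-suc _ _))
      (+-mono-≤ (killed-here g gs live-q dead-q) (liveCount-kill gs p live-p dead-p))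
  liveCount-kill₂ (g ∷ gs) (suc p) (suc q) p≢q live-p dead-p live-q dead-q =
    subst (_≤ liveCount S? (g ∷ gs)) (trans (+-suc _ _) (cong suc (+-suc _ _)))
      (+-mono-≤ (live-mono g gs)
                (liveCount-kill₂ gs p q (p≢q ∘ cong suc) live-p dead-p live-q dead-q))

-- K plays the class generated from x_v.  The gates in E count as members of K,
-- which lets a second pass look past a gate that has already been found.
module Propagation {S : Pred (Cube m) 0ℓ} (S? : Decidable S) (v : Fin m)
  (flip-∈ : ∀ {x} → x ∈ S → flipAt v x ∈ S)
  (K : Pred (Cube m → Bool) 0ℓ)
  (K-resp : ∀ {φ ψ} → φ ≗ ψ → K φ → K ψ)
  (K-op : ∀ (f : Op₂ Bool) {u w} → Constant S u → K w → K (λ x → f (u x) (w x)))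
  (K-var : K λ x → lookup x v)
  where

  Escape : (gs : Gates m k) → Pred (Fin k) 0ℓ → Set
  Escape gs E = ∃ λ p → p ∉ E × Live S (gateAt gs p) × FedBy K (gateAt gs p)

  Classified : (gs : Gates m k) → Pred (Fin k) 0ℓ → (Cube m → Bool) → Set
  Classified gs E φ = Escape gs E ⊎ Independent S v φ ⊎ K φ

  private
    Independent-resp : ∀ {φ ψ} → φ ≗ ψ → Independent S v φ → Independent S v ψ
    Independent-resp φ≗ψ indep {x} x∈ =
      trans (sym (φ≗ψ x)) (trans (indep x∈) (φ≗ψ (flipAt v x)))

    Independent-op : ∀ (f : Op₂ Bool) {u w} → Independent S v u → Independent S v w →
                     Independent S v (λ x → f (u x) (w x))
    Independent-op f u-indep w-indep x∈ = cong₂ f (u-indep x∈) (w-indep x∈)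

    Independent-with-constant : ∀ (f : Op₂ Bool) {u w} → Constant S u → Independent S v w →
                                Independent S v (λ x → f (u x) (w x))
    Independent-with-constant f u-const w-indep x∈ =
      cong₂ f (u-const x∈ (flip-∈ x∈)) (w-indep x∈)

    K-not : ∀ {u} → K u → K (not ∘ u)
    K-not = K-op (λ _ → not) {u = λ _ → true} λ _ _ → refl

    classified-resp : ∀ {gs : Gates m k} {E φ ψ} → φ ≗ ψ →
                      Classified gs E φ → Classified gs E ψ
    classified-resp φ≗ψ = Sum.map₂ (Sum.map (Independent-resp φ≗ψ) (K-resp φ≗ψ))

    lift : ∀ {g : Gate m k} {gs E φ} → Classified gs (E ∘ suc) φ → Classified (g ∷ gs) E φ
    lift = Sum.map₁ λ (p , p∉E , live , fed) → suc p , p∉E , live , fed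

    classify-input : ∀ i → Independent S v (node {m} [] i) ⊎ K (node [] i)
    classify-input i with subst Fin (+-identityʳ m) i ≟ v
    ... | yes j≡v =
      inj₂ (K-resp (λ x → sym (trans (node-input i x) (cong (lookup x) j≡v))) K-var)
    ... | no j≢v  = inj₁ (Independent-resp (λ x → sym (node-input i x))
                          λ {x} _ → sym (lookup∘updateAt′ _ v j≢v x))

    -- ops says that u and w are the operands of g.
    classify-live : ∀ {g : Gate m k} {gs E} (f : Op₂ Bool) {u w} →
                    (ops : ∀ {R} → R u w → Operands R (gs ⊢ g)) →
                    ¬ Constant S u → ¬ Constant S w →
                    Dec (zero ∈ E) → (zero ∈ E → K (λ x → f (u x) (w x))) →
                    Independent S v u ⊎ K u → Independent S v w ⊎ K w →
                    Classified (g ∷ gs) E (λ x → f (u x) (w x))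
    classify-live f ops ¬cu ¬cw (yes zero∈E) zero⇒K _ _ = inj₂ (inj₂ (zero⇒K zero∈E))
    classify-live f ops ¬cu ¬cw (no zero∉E) _ (inj₂ Ku) _ =
      inj₁ (zero , zero∉E , ops (¬cu , ¬cw) , ops (inj₁ Ku))
    classify-live f ops ¬cu ¬cw (no zero∉E) _ (inj₁ _) (inj₂ Kw) =
      inj₁ (zero , zero∉E , ops (¬cu , ¬cw) , ops (inj₂ Kw))
    classify-live f ops ¬cu ¬cw (no zero∉E) _ (inj₁ u-indep) (inj₁ w-indep) =
      inj₂ (inj₁ (Independent-op f u-indep w-indep))

    classify-binary : ∀ {g : Gate m k} {gs E} (f : Op₂ Bool) {u w} →
                      (ops : ∀ {R} → R u w → Operands R (gs ⊢ g)) →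
                      Dec (zero ∈ E) → (zero ∈ E → K (λ x → f (u x) (w x))) →
                      Classified (g ∷ gs) E u → Classified (g ∷ gs) E w →
                      Classified (g ∷ gs) E (λ x → f (u x) (w x))
    classify-binary f ops zero∈E? zero⇒K (inj₁ esc) _          = inj₁ esc
    classify-binary f ops zero∈E? zero⇒K (inj₂ _)   (inj₁ esc) = inj₁ esc
    classify-binary f {u} {w} ops zero∈E? zero⇒K (inj₂ cu) (inj₂ cw)
      with constant? S? u | constant? S? w
    ... | yes u-const | _ =
      inj₂ (Sum.map (Independent-with-constant f u-const) (K-op f u-const) cw)
    ... | no _ | yes w-const =
      inj₂ (Sum.map (Independent-with-constant (flip f) w-const) (K-op (flip f) w-const) cu)
    ... | no ¬cu | no ¬cw = classify-live f ops ¬cu ¬cw zero∈E? zero⇒K cu cw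

    classify-gate : ∀ (g : Gate m k) gs {E} → Dec (zero ∈ E) → (zero ∈ E → K (value (gs ⊢ g))) →
                    (∀ j → Classified (g ∷ gs) E (node gs j)) →
                    Classified (g ∷ gs) E (value (gs ⊢ g))
    classify-gate (AND a b) gs zero∈E? zero⇒K below =
      classify-binary _∧_ id zero∈E? zero⇒K (below a) (below b)
    classify-gate (OR a b)  gs zero∈E? zero⇒K below =
      classify-binary _∨_ id zero∈E? zero⇒K (below a) (below b)
    classify-gate (NOT a)   gs zero∈E? zero⇒K below =
      Sum.map₂ (Sum.map (λ indep x∈ → cong not (indep x∈)) K-not) (below a)

  classify : (gs : Gates m k) (E : Pred (Fin k) 0ℓ) → Decidable E →
             (∀ {p} → p ∈ E → K (value (gateAt gs p))) → ∀ i → Classified gs E (node gs i)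
  classify []       E E? E⇒K i = inj₂ (classify-input i)
  classify (g ∷ gs) E E? E⇒K i =
    [ (λ (j , eq) → classified-resp {gs = g ∷ gs} (sym ∘ eq) (below j))
    , (λ eq → classified-resp {gs = g ∷ gs} (sym ∘ eq)
                (classify-gate g gs (E? zero) E⇒K below))
    ]′ (node-∷ g gs i)
    where
    below : ∀ j → Classified (g ∷ gs) E (node gs j)
    below = lift {g = g} ∘ classify gs (E ∘ suc) (E? ∘ suc) λ {p} → E⇒K {suc p}

  escape : (gs : Gates m k) (E : Pred (Fin k) 0ℓ) → Decidable E →
           (∀ {p} → p ∈ E → K (value (gateAt gs p))) →
           ∀ i → ¬ Independent S v (node gs i) → ¬ K (node gs i) → Escape gs E
  escape gs E E? E⇒K i ¬indep ¬K =
    [ id , [ ⊥-elim ∘ ¬indep , ⊥-elim ∘ ¬K ]′ ]′ (classify gs E E? E⇒K i)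

module Elimination {S : Pred (Cube m) 0ℓ} (S? : Decidable S) (v : Fin m)
  (flip-∈ : ∀ {x} → x ∈ S → flipAt v x ∈ S) where

  Fix : Bool → Pred (Cube m) 0ℓ
  Fix c = S ∩ λ x → lookup x v ≡ c

  Fix? : ∀ c → Decidable (Fix c)
  Fix? c = S? ∩? λ x → lookup x v ≟ᴮ c

  Fix⊆S : ∀ {c} → Fix c ⊆ S
  Fix⊆S = proj₁

  Constant-Fix : ∀ {c u} → Constant S u → Constant (Fix c) u
  Constant-Fix {c} = Constant-⊆ (Fix⊆S {c})

  Determined : Pred (Cube m → Bool) 0ℓ
  Determined φ = ∀ c → Constant (Fix c) φ

  private
    lookup-constant : ∀ c → Constant (Fix c) λ x → lookup x v
    lookup-constant c (_ , x≡c) (_ , y≡c) = trans x≡c (sym y≡c)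

    module OnHalf (c : Bool) = Propagation S? v flip-∈ (Constant (Fix c))
      Constant-resp (λ f u-const → Constant-op f (Constant-Fix u-const)) (lookup-constant c)

    Determined-resp : ∀ {φ ψ} → φ ≗ ψ → Determined φ → Determined ψ
    Determined-resp φ≗ψ det c = Constant-resp {S = Fix c} φ≗ψ (det c)

    Determined-op : ∀ (f : Op₂ Bool) {u w} → Constant S u → Determined w →
                    Determined (λ x → f (u x) (w x))
    Determined-op f u-const det c = Constant-op {S = Fix c} f (Constant-Fix u-const) (det c)

    module OnBoth = Propagation S? v flip-∈ Determined Determined-resp Determined-op lookup-constant

    pinned? : ∀ (u : Cube m → Bool) e c → Dec (∀ x → x ∈ Fix c → u x ≡ e)
    pinned? u e c = ∀-cube? λ x → Fix? c x →-dec (u x ≟ᴮ e)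

  pin : ∀ {u} → Determined u → ¬ Constant S u → ∀ e → ∃ λ c → ∀ {x} → x ∈ Fix c → u x ≡ e
  pin {u} det ¬const e with pinned? u e false | pinned? u e true
  ... | yes on-false | _           = false , on-false _
  ... | no _         | yes on-true = true , on-true _
  ... | no ¬on-false | no ¬on-true =
    ⊥-elim (¬const λ x∈ y∈ → trans (avoids x∈) (sym (avoids y∈)))
    where
    ¬on : ∀ c → ¬ (∀ x → x ∈ Fix c → u x ≡ e)
    ¬on false = ¬on-false
    ¬on true  = ¬on-true
    avoids : ∀ {x} → x ∈ S → u x ≡ not e
    avoids {x} x∈S = ¬-not λ ux≡e →
      ¬on (lookup x v) λ z z∈ → trans (det (lookup x v) z∈ (x∈S , refl)) ux≡e

  pin⇒constant : ∀ {u φ : Cube m → Bool} → ¬ Constant S u → Determined u →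
                 ∀ e {z} → (∀ {x} → u x ≡ e → φ x ≡ z) → ∃ λ c → Constant (Fix c) φ
  pin⇒constant ¬cu du e u≡e⇒φ≡z with pin du ¬cu e
  ... | c , u≡e = c , λ x∈ y∈ → trans (u≡e⇒φ≡z (u≡e x∈)) (sym (u≡e⇒φ≡z (u≡e y∈)))

  controlling-value : ∀ γ → Live S γ → FedBy Determined γ → ∃ λ c → Constant (Fix c) (value γ)
  controlling-value (gs ⊢ AND a b) (¬cu , _) (inj₁ du) =
    pin⇒constant ¬cu du false λ u≡ → cong (_∧ _) u≡
  controlling-value (gs ⊢ AND a b) (_ , ¬cw) (inj₂ dw) =
    pin⇒constant ¬cw dw false λ w≡ → trans (cong (_ ∧_) w≡) (∧-zeroʳ _)
  controlling-value (gs ⊢ OR a b)  (¬cu , _) (inj₁ du) =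
    pin⇒constant ¬cu du true λ u≡ → cong (_∨ _) u≡
  controlling-value (gs ⊢ OR a b)  (_ , ¬cw) (inj₂ dw) =
    pin⇒constant ¬cw dw true λ w≡ → trans (cong (_ ∨_) w≡) (∨-zeroʳ _)

  eliminate₁ : (gs : Gates m k) (i : Fin (m + k)) (c : Bool) →
               ¬ Independent S v (node gs i) → ¬ Constant (Fix c) (node gs i) →
               liveCount (Fix? c) gs < liveCount S? gs
  eliminate₁ gs i c ¬indep ¬const with OnHalf.escape c gs ∅ ∅? (λ ()) i ¬indep ¬const
  ... | p , _ , live , fed =
    liveCount-kill (Fix? c) S? Fix⊆S gs p live (FedBy-Constant⇒¬Live (gateAt gs p) fed)

  eliminate₂ : (gs : Gates m k) (i : Fin (m + k)) →
               ¬ Independent S v (node gs i) → (∀ c → ¬ Constant (Fix c) (node gs i)) →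
               ∃ λ c → 2 + liveCount (Fix? c) gs ≤ liveCount S? gs
  eliminate₂ gs i ¬indep ¬const
    with OnBoth.escape gs ∅ ∅? (λ ()) i ¬indep (λ det → ¬const false (det false))
  ... | G , _ , G-live , G-fed with controlling-value (gateAt gs G) G-live G-fed
  ... | c , G-const
    with OnHalf.escape c gs (_≡ G) (_≟ G) (λ { refl → G-const }) i ¬indep (¬const c)
  ... | H , H≢G , H-live , H-fed =
    c , liveCount-kill₂ (Fix? c) S? Fix⊆S gs G H (H≢G ∘ sym)
          G-live (dead G (Operands-map (gateAt gs G) (Sum.map (_$ c) (_$ c)) G-fed))
          H-live (dead H H-fed)
    where
    dead : ∀ p → FedBy (Constant (Fix c)) (gateAt gs p) → ¬ Live (Fix c) (gateAt gs p)
    dead p = FedBy-Constant⇒¬Live (gateAt gs p)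

binVal-replicate-false : ∀ n → binVal (replicate n false) ≡ 0
binVal-replicate-false zero    = refl
binVal-replicate-false (suc n) = binVal-replicate-false n

binVal-flipAt-zeros : ∀ {n} (i : Fin n) → 0 < binVal (flipAt i (replicate n false))
binVal-flipAt-zeros {suc n} zero    = <-≤-trans (m^n>0 2 n) (m≤m+n _ _)
binVal-flipAt-zeros {suc n} (suc i) = binVal-flipAt-zeros i

binVal-surjective : ∀ n {k} → k < 2 ^ n → ∃ λ (a : Vec Bool n) → binVal a ≡ k
binVal-surjective zero    {zero} _ = [] , refl
binVal-surjective zero    {suc k} (s≤s ())
binVal-surjective (suc n) {k} k<2N with k <? 2 ^ n
... | yes k<N = Product.map (false ∷_) id (binVal-surjective n k<N)
... | no k≮N  = Product.map (true ∷_) (λ e → trans (cong (2 ^ n +_) e) (m+[n∸m]≡n N≤k))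
                  (binVal-surjective n k∸N<N)
  where
  N≤k : 2 ^ n ≤ k
  N≤k = ≮⇒≥ k≮N
  k∸N<N : k ∸ 2 ^ n < 2 ^ n
  k∸N<N = +-cancelˡ-< (2 ^ n) _ _ (begin-strict
    2 ^ n + (k ∸ 2 ^ n)  ≡⟨ m+[n∸m]≡n N≤k ⟩
    k                    <⟨ k<2N ⟩
    2 ^ n + (2 ^ n + 0)  ≡⟨ cong (2 ^ n +_) (+-identityʳ _) ⟩
    2 ^ n + 2 ^ n        ∎)
    where open ≤-Reasoning

module Multiplexer (n : ℕ) where

  Input : Set
  Input = Cube (n + 2 ^ n)

  address : Fin n → Fin (n + 2 ^ n)
  address i = i ↑ˡ 2 ^ n

  datum : Fin (2 ^ n) → Fin (n + 2 ^ n)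
  datum j = n ↑ʳ j

  address≢datum : ∀ i j → address i ≢ datum j
  address≢datum i j eq
    with trans (sym (splitAt-↑ˡ n i (2 ^ n))) (trans (cong (splitAt n) eq) (splitAt-↑ʳ n (2 ^ n) j))
  ... | ()

  record Stage (t k : ℕ) (d : Vec Bool (2 ^ n)) (z : Input) : Set where
    constructor stage
    field
      address-zero : ∀ i → toℕ i < t → lookup z (address i) ≡ false
      datum-agrees : ∀ j → k ≤ toℕ j → lookup z (datum j) ≡ lookup d j

  stage? : ∀ t k d → Decidable (Stage t k d)
  stage? t k d z = map′ (λ (zero-below , agree) → stage zero-below agree)
                        (λ (stage zero-below agree) → zero-below , agree)
    (all? (λ i → toℕ i <? t →-dec (lookup z (address i) ≟ᴮ false))
      ×-dec all? (λ j → k ≤? toℕ j →-dec (lookup z (datum j) ≟ᴮ lookup d j)))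

  flipAt-address-∈ : ∀ {t k d} i → t ≤ toℕ i → Stage t k d ⊆ Stage t k d ∘ flipAt (address i)
  flipAt-address-∈ i t≤i {z} (stage zero-below agree) = stage
    (λ i′ i′<t →
      trans (lookup∘updateAt′ _ _ (i′≢i i′<t ∘ ↑ˡ-injective _ i′ i) z) (zero-below i′ i′<t))
    (λ j k≤j → trans (lookup∘updateAt′ _ _ (address≢datum i j ∘ sym) z) (agree j k≤j))
    where
    i′≢i : ∀ {i′} → toℕ i′ < _ → i′ ≢ i
    i′≢i i′<t refl = <⇒≢ (<-≤-trans i′<t t≤i) refl

  flipAt-datum-∈ : ∀ {t k d} j → toℕ j < k → Stage t k d ⊆ Stage t k d ∘ flipAt (datum j)
  flipAt-datum-∈ j j<k {z} (stage zero-below agree) = stage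
    (λ i i<t → trans (lookup∘updateAt′ _ _ (address≢datum i j) z) (zero-below i i<t))
    (λ j′ k≤j′ →
      trans (lookup∘updateAt′ _ _ (j′≢j k≤j′ ∘ ↑ʳ-injective n j′ j) z) (agree j′ k≤j′))
    where
    j′≢j : ∀ {j′} → _ ≤ toℕ j′ → j′ ≢ j
    j′≢j k≤j′ refl = <⇒≢ (<-≤-trans j<k k≤j′) refl

  fix-datum-⊆ : ∀ {t k d} j c → toℕ j ≡ k →
                Stage t k (d [ j ]≔ c) ⊆ Stage t (suc k) d ∩ λ z → lookup z (datum j) ≡ c
  fix-datum-⊆ {d = d} j c refl (stage zero-below agree) =
    stage zero-below
          (λ j′ j<j′ → trans (agree j′ (<⇒≤ j<j′)) (lookup∘update′ (j′≢j j<j′) d c)) ,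
    trans (agree j ≤-refl) (lookup∘update j d c)
    where
    j′≢j : ∀ {j′} → toℕ j < toℕ j′ → j′ ≢ j
    j′≢j j<j′ refl = <⇒≢ j<j′ refl

  fix-address-⊆ : ∀ {t k d} i → toℕ i ≡ t →
                  Stage (suc t) k d ⊆ Stage t k d ∩ λ z → lookup z (address i) ≡ false
  fix-address-⊆ i refl (stage zero-below agree) =
    stage (λ i′ i′<t → zero-below i′ (m<n⇒m<1+n i′<t)) agree , zero-below i ≤-refl

  zeros : Vec Bool n
  zeros = replicate n false

  origin : Fin (2 ^ n)
  origin = fromℕ< (m^n>0 2 n)

  ≢origin : ∀ {j} → 0 < toℕ j → j ≢ origin
  ≢origin 0<j refl = <⇒≢ 0<j (sym (toℕ-fromℕ< (m^n>0 2 n)))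

  probe : Vec Bool (2 ^ n) → Bool → Input
  probe d b = zeros ++ (d [ origin ]≔ b)

  probe-∈ : ∀ {t k} d b → probe d b ∈ Stage t (suc k) d
  probe-∈ d b = stage
    (λ i _ → trans (lookup-++ˡ zeros _ i) (lookup-replicate i false))
    (λ j k<j →
      trans (lookup-++ʳ zeros _ j) (lookup∘update′ (≢origin (<-≤-trans (s≤s z≤n) k<j)) d b))

  MUX-select : ∀ {a : Vec Bool n} x j → binVal a ≡ toℕ j → MUX n a x ≡ lookup x j
  MUX-select {a} x j a↦j =
    cong (lookup x) (toℕ-injective (trans (toℕ-fromℕ< (binVal< a)) a↦j))

  module Computing {K} (gs : Gates (n + 2 ^ n) K) (out : Fin (n + 2 ^ n + K))
    (computes : ∀ a x → node gs out (a ++ x) ≡ MUX n a x) where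

    f : Input → Bool
    f = node gs out

    f-probe : ∀ d b → f (probe d b) ≡ b
    f-probe d b = begin
      f (probe d b)                    ≡⟨ computes zeros _ ⟩
      MUX n zeros (d [ origin ]≔ b)    ≡⟨ MUX-select (d [ origin ]≔ b) origin zeros↦origin ⟩
      lookup (d [ origin ]≔ b) origin  ≡⟨ lookup∘update origin d b ⟩
      b                                ∎
      where
      open ≡-Reasoning
      zeros↦origin : binVal zeros ≡ toℕ origin
      zeros↦origin = trans (binVal-replicate-false n) (sym (toℕ-fromℕ< _))

    nonconstant : ∀ {t k d} {T : Pred Input 0ℓ} → Stage t (suc k) d ⊆ T → ¬ Constant T f
    nonconstant {d = d} stage⊆T const = not-¬ refl (begin
      false              ≡⟨ sym (f-probe d false) ⟩
      f (probe d false)  ≡⟨ const (stage⊆T (probe-∈ d false)) (stage⊆T (probe-∈ d true)) ⟩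
      f (probe d true)   ≡⟨ f-probe d true ⟩
      true               ∎)
      where open ≡-Reasoning

    datum-relevant : ∀ {k d} j → ¬ Independent (Stage 0 k d) (datum j) f
    datum-relevant {d = d} j indep with binVal-surjective n (toℕ<n j)
    ... | a , a↦j = not-¬ refl (begin
      lookup d j                       ≡⟨ sym (MUX-select d j a↦j) ⟩
      MUX n a d                        ≡⟨ sym (computes a d) ⟩
      f (a ++ d)                       ≡⟨ indep (stage (λ _ ()) λ j′ _ → lookup-++ʳ a d j′) ⟩
      f (flipAt (datum j) (a ++ d))    ≡⟨ cong f (updateAt-++ʳ a d j) ⟩
      f (a ++ flipAt j d)              ≡⟨ computes a _ ⟩
      MUX n a (flipAt j d)             ≡⟨ MUX-select (flipAt j d) j a↦j ⟩
      lookup (flipAt j d) j            ≡⟨ lookup∘updateAt j d ⟩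
      not (lookup d j)                 ∎)
      where open ≡-Reasoning

    -- Flipping bit i of the zero address moves the read from the origin, which
    -- holds b, to an index j ≠ origin, which still holds d_j = not b.
    address-relevant : ∀ {t k d} i → ¬ Independent (Stage t (suc k) d) (address i) f
    address-relevant {d = d} i indep = not-¬ refl (begin
      lookup d j                                   ≡⟨ sym (lookup∘update′ j≢origin d b) ⟩
      lookup (d [ origin ]≔ b) j                   ≡⟨ sym (computes a _) ⟩
      f (a ++ (d [ origin ]≔ b))                   ≡⟨ cong f (sym (updateAt-++ˡ zeros _ i)) ⟩
      f (flipAt (address i) (probe d b))           ≡⟨ sym (indep (probe-∈ d b)) ⟩
      f (probe d b)                                ≡⟨ f-probe d b ⟩
      b                                            ∎)
      where
      open ≡-Reasoning
      a = flipAt i zeros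
      j = fromℕ< (binVal< a)
      b = not (lookup d j)
      j≢origin : j ≢ origin
      j≢origin = ≢origin (subst (0 <_) (sym (toℕ-fromℕ< (binVal< a))) (binVal-flipAt-zeros i))

    live : ℕ → ℕ → Vec Bool (2 ^ n) → ℕ
    live t k d = liveCount (stage? t k d) gs

    fix-datum : ∀ {k} d j → toℕ j ≡ suc k →
                ∃ λ d′ → 2 + live 0 (suc k) d′ ≤ live 0 (suc (suc k)) d
    fix-datum {k} d j j≡ =
      Product.map (d [ j ]≔_)
        (λ {c} → ≤-trans (+-monoʳ-≤ 2 (liveCount-mono (stage? _ _ _) (E.Fix? c) (fix-datum-⊆ j c j≡) gs)))
        (E.eliminate₂ gs out (datum-relevant j) λ c → nonconstant (fix-datum-⊆ j c j≡))
      where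
      module E = Elimination (stage? 0 (suc (suc k)) d) (datum j)
                             (flipAt-datum-∈ j (≤-reflexive (cong suc j≡)))

    fix-address : ∀ {t} d i → toℕ i ≡ t → live (suc t) 1 d < live t 1 d
    fix-address {t} d i i≡ =
      ≤-<-trans (liveCount-mono (stage? _ _ _) (E.Fix? false) (fix-address-⊆ i i≡) gs)
        (E.eliminate₁ gs out false (address-relevant i) (nonconstant (fix-address-⊆ i i≡)))
      where
      module E = Elimination (stage? t 1 d) (address i)
                             (flipAt-address-∈ i (≤-reflexive (sym i≡)))

    address-phase : ∀ s {t} d → s + t ≡ n → s ≤ live t 1 d
    address-phase zero    d _  = z≤n
    address-phase (suc s) {t} d s+t≡ =
      <-≤-trans (s≤s (address-phase s {suc t} d (trans (+-suc s t) s+t≡)))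
        (fix-address d (fromℕ< t<n) (toℕ-fromℕ< t<n))
      where
      t<n : t < n
      t<n = ≤-trans (s≤s (m≤n+m t s)) (≤-reflexive s+t≡)

    data-phase : ∀ k d → k < 2 ^ n → 2 * k + n ≤ live 0 (suc k) d
    data-phase zero    d _   = address-phase n d (+-identityʳ n)
    data-phase (suc k) d k<N =
      let d′ , killed = fix-datum d (fromℕ< k<N) (toℕ-fromℕ< k<N) in begin
      2 * suc k + n          ≡⟨ cong (_+ n) (*-suc 2 k) ⟩
      2 + 2 * k + n          ≡⟨ +-assoc 2 (2 * k) n ⟩
      2 + (2 * k + n)        ≤⟨ +-monoʳ-≤ 2 (data-phase k d′ (<⇒≤ k<N)) ⟩
      2 + live 0 (suc k) d′  ≤⟨ killed ⟩
      live 0 (suc (suc k)) d ∎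
      where open ≤-Reasoning

theorem12 : (n : ℕ) → 1 ≤ n → (c : Circuit (n + 2 ^ n)) → Computes-MUX n c →
    2 * 2 ^ n + n ≤ size c + 2
theorem12 n _ (circuit _ gs out) computes = begin
  2 * 2 ^ n + n      ≡⟨ cong (λ N → 2 * N + n) (sym N-1+1≡N) ⟩
  2 * suc N-1 + n    ≡⟨ cong (_+ n) (*-suc 2 N-1) ⟩
  2 + 2 * N-1 + n    ≡⟨ +-assoc 2 (2 * N-1) n ⟩
  2 + (2 * N-1 + n)  ≤⟨ +-monoʳ-≤ 2 (data-phase N-1 d (≤-reflexive N-1+1≡N)) ⟩
  2 + live 0 N d     ≤⟨ +-monoʳ-≤ 2 (liveCount≤size (stage? 0 N d) gs) ⟩
  2 + gatesSize gs   ≡⟨ +-comm 2 _ ⟩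
  gatesSize gs + 2   ∎
  where
  open ≤-Reasoning
  open Multiplexer n
  open Computing gs out computes
  N-1 = pred (2 ^ n)
  N = suc N-1
  N-1+1≡N : N ≡ 2 ^ n
  N-1+1≡N = suc-pred (2 ^ n) {{m^n≢0 2 n}}
  d = replicate (2 ^ n) false
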